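{- Let $m\ge3$, $1\le a\le b<\frac m2$, $1\le c\le\frac m2$. If at least one of the following conditions fails, then $B_2(m;a,b,c)$ is not a nut graph: (i) $m$ is coprime to each of $\gcd(a-b,a+b+c)$, $\gcd(a-b,a+b-c)$, $\gcd(a+b,a-b+c)$, $\gcd(a+b,a-b-c)$; (ii) if $v_2(m)>v_2(c)$, then neither $v_2(a)$ nor $v_2(b)$ equals $v_2(c)-1$.
   Context: A graph is a nut graph if $0$ is an adjacency eigenvalue of multiplicity one and a corresponding eigenvector has no zero entries. $B_2(m;a,b,c)$ is the graph on vertices $x_0,\dots,x_{m-1},y_0,\dots,y_{m-1}$ (indices mod $m$) with edges $x_ix_{i\pm a}$, $y_iy_{i\pm b}$, $x_iy_i$ and $x_iy_{i+c}$ for all $i$. For a nonzero integer $x$, $v_2(x)$ is the exponent of $2$ in the prime factorization of $|x|$. -}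

module Defs where

open import Data.Bool using (Bool; true; false; _∨_; if_then_else_)
open import Data.Nat as ℕ using (ℕ; zero; suc; NonZero; _%_; _/_)
open import Data.Nat.GCD as NG using ()
open import Data.Integer as ℤ using (ℤ)
open import Data.Fin using (Fin; toℕ)
import Data.Fin as F
open import Data.Sum using (_⊎_; inj₁; inj₂)
open import Data.Product using (Σ; _×_; _,_)
open import Data.Rational as ℚ using (ℚ; 0ℚ; 1ℚ)
open import Relation.Nullary using (¬_; does)
open import Relation.Binary.PropositionalEquality using (_≡_)

Σℚ : (n : ℕ) → (Fin n → ℚ) → ℚ
Σℚ zero    f = 0ℚ
Σℚ (suc n) f = f F.zero ℚ.+ Σℚ n (λ i → f (F.suc i))

Graph : ℕ → Set
Graph n = Fin n → Fin n → Bool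

adjMat : ∀ {n} → Graph n → Fin n → Fin n → ℚ
adjMat G u w = if G u w then 1ℚ else 0ℚ

InKernel : ∀ {n} → Graph n → (Fin n → ℚ) → Set
InKernel {n} G v = ∀ u → Σℚ n (λ w → adjMat G u w ℚ.* v w) ≡ 0ℚ

-- nut graph: 0 is an eigenvalue of multiplicity one (the kernel is the span
-- of a single nonzero vector v), and such an eigenvector has no zero entries.
IsNut : ∀ {n} → Graph n → Set
IsNut {n} G =
  Σ (Fin n → ℚ) λ v →
    InKernel G v
    × (∀ u → ¬ (v u ≡ 0ℚ))
    × (∀ w → InKernel G w → Σ ℚ λ t → ∀ u → w u ≡ t ℚ.* v u)

-- vertex x_i ↦ inj₁ i, vertex y_i ↦ inj₂ i  (i : Fin m)

-- j ≡ i + k (mod m), with i, j residues in [0, m)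
_≡_+_[mod_] : ℕ → ℕ → ℕ → (m : ℕ) → .{{NonZero m}} → Bool
j ≡ i + k [mod m ] = does ((i ℕ.+ k) % m ℕ.≟ j)

-- adjacency of B₂(m;a,b,c) on Fin m ⊎ Fin m:
--   x_i ~ x_{i±a},  y_i ~ y_{i±b},  x_i ~ y_i,  x_i ~ y_{i+c}
B2adj : (m a b c : ℕ) → .{{NonZero m}} → Fin m ⊎ Fin m → Fin m ⊎ Fin m → Bool
B2adj m a b c (inj₁ i) (inj₁ j) =
  (toℕ j ≡ toℕ i + a [mod m ]) ∨ (toℕ i ≡ toℕ j + a [mod m ])
B2adj m a b c (inj₂ i) (inj₂ j) =
  (toℕ j ≡ toℕ i + b [mod m ]) ∨ (toℕ i ≡ toℕ j + b [mod m ])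
B2adj m a b c (inj₁ i) (inj₂ j) =
  (toℕ j ≡ toℕ i + 0 [mod m ]) ∨ (toℕ j ≡ toℕ i + c [mod m ])
B2adj m a b c (inj₂ j) (inj₁ i) =
  (toℕ j ≡ toℕ i + 0 [mod m ]) ∨ (toℕ j ≡ toℕ i + c [mod m ])

B2 : (m a b c : ℕ) → .{{NonZero m}} → Graph (m ℕ.+ m)
B2 m a b c u w = B2adj m a b c (F.splitAt m u) (F.splitAt m w)

gcdℤ : ℤ → ℤ → ℕ
gcdℤ i j = NG.gcd ℤ.∣ i ∣ ℤ.∣ j ∣

-- 2-adic valuation v₂(n) of a positive natural n (fuel-based; v2 0 = 0 is
-- never used)
v2aux : ℕ → ℕ → ℕ
v2aux zero    n = 0
v2aux (suc f) zero = 0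
v2aux (suc f) (suc n) with (suc n) % 2
... | zero  = suc (v2aux f (suc n / 2))
... | suc _ = 0

v2 : ℕ → ℕ
v2 n = v2aux n n

-- A vector on B₂(m;a,b,c) given by m-periodic functions V, W : ℤ → ℚ on the x- and y-cycle lies
-- in the kernel as soon as, for every i,
--   V(i+a) + V(i−a) + W(i) + W(i+c) = 0   and   V(i) + V(i−c) + W(i+b) + W(i−b) = 0,
-- and in a nut graph no kernel vector has both a zero and a nonzero entry.
-- If (i) fails, some d ≥ 2 divides m and both entries of one of the four gcds; choosing the signs
-- s = ±a, t = ±b with d ∣ s − t and d ∣ s + t + c, the pair V = [d ∣ ·], W = −[d ∣ · + s] solves
-- the equations.  If (ii) fails, put T = 2^v₂(c): then 2T divides m, c − T, and 2a − T or 2b − T.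
-- The function φ = [2T ∣ ·] − [2T ∣ · − T] satisfies φ(y) + φ(z) = 0 whenever 2T ∣ y − z − T,
-- so (φ, 0) resp. (0, φ) solves the equations.  Each of these vectors vanishes somewhere but not
-- everywhere.

module Submission where

open import Defs
open import Data.Bool using (Bool; _∨_; if_then_else_)
open import Data.Empty using (⊥)
open import Data.Fin as F using (Fin; toℕ; _↑ˡ_; _↑ʳ_)
import Data.Fin.Properties as FP
open import Data.Integer as ℤ using (ℤ; +_; -_; _+_; _-_; 0ℤ; _%ℕ_; _/ℕ_)
open import Data.Integer.DivMod using (a≡a%ℕn+[a/ℕn]*n; n%ℕd<d)
open import Data.Integer.Divisibility.Signed
  using (_∣_; _∣?_; divides; ∣⇒∣ᵤ; ∣ᵤ⇒∣; ∣-refl; ∣-trans; ∣m⇒∣-m; ∣m∣n⇒∣m+n; ∣m∣n⇒∣m-n)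
import Data.Integer.Properties as ℤP
open import Data.Integer.Tactic.RingSolver using (solve-∀)
open import Data.Nat as ℕ using (ℕ; zero; suc; _≤_; _<_; _*_; _^_; _%_; _/_; NonZero; z≤n; s≤s)
open import Data.Nat.Coprimality using (Coprime)
import Data.Nat.Divisibility as ℕD
open import Data.Nat.DivMod using (m≡m%n+[m/n]*n; m%n<n; m/n<m)
open import Data.Nat.GCD using (gcd[m,n]∣m; gcd[m,n]∣n)
import Data.Nat.Properties as ℕP
import Data.Nat.Tactic.RingSolver as ℕSolver
open import Data.Product using (_×_; _,_; ∃-syntax; proj₁; proj₂)
open import Data.Rational as ℚ using (ℚ; 0ℚ; 1ℚ)
import Data.Rational.Properties as ℚP
open import Data.Rational.Solver using (module +-*-Solver)
open import Data.Sum using (_⊎_; inj₁; inj₂; [_,_]′)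
open import Function using (_∘_)
open import Function.Bundles using (_⇔_; mk⇔)
open import Relation.Binary.PropositionalEquality
  using (_≡_; _≢_; refl; sym; trans; cong; cong₂; subst; module ≡-Reasoning)
open import Relation.Nullary using (¬_; Dec; yes; no; does; contradiction)
open import Relation.Nullary.Decidable using (does-⇔; dec-true; dec-false)

open import Algebra.Properties.CommutativeMonoid.Sum ℚP.+-0-commutativeMonoid
  using (sum; sum-cong-≗; sum-replicate-zero; ∑-distrib-+)

[_] : Bool → ℚ
[ b ] = if b then 1ℚ else 0ℚ

Σℚ≡sum : ∀ n (f : Fin n → ℚ) → Σℚ n f ≡ sum f
Σℚ≡sum zero    f = refl
Σℚ≡sum (suc n) f = cong (f F.zero ℚ.+_) (Σℚ≡sum n (f ∘ F.suc))

sum-↑ˡ-↑ʳ : ∀ m {n} (f : Fin (m ℕ.+ n) → ℚ) →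
  sum f ≡ sum (f ∘ (_↑ˡ n)) ℚ.+ sum (f ∘ (m ↑ʳ_))
sum-↑ˡ-↑ʳ zero    f = sym (ℚP.+-identityˡ _)
sum-↑ˡ-↑ʳ (suc m) {n} f =
  trans (cong (f F.zero ℚ.+_) (sum-↑ˡ-↑ʳ m (f ∘ F.suc)))
        (sym (ℚP.+-assoc (f F.zero) (sum (f ∘ F.suc ∘ (_↑ˡ n))) (sum (f ∘ F.suc ∘ (m ↑ʳ_)))))

sum-indicator : ∀ {n} k → k < n → (f : ℕ → ℚ) →
  sum {n} (λ j → [ does (k ℕ.≟ toℕ j) ] ℚ.* f (toℕ j)) ≡ f k
sum-indicator {suc n} zero _ f = begin
  1ℚ ℚ.* f 0 ℚ.+ sum {n} (λ j → 0ℚ ℚ.* f (suc (toℕ j)))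
    ≡⟨ cong₂ ℚ._+_ (ℚP.*-identityˡ (f 0)) (sum-cong-≗ {n} (λ j → ℚP.*-zeroˡ (f (suc (toℕ j))))) ⟩
  f 0 ℚ.+ sum {n} (λ _ → 0ℚ)
    ≡⟨ cong (f 0 ℚ.+_) (sum-replicate-zero n) ⟩
  f 0 ℚ.+ 0ℚ
    ≡⟨ ℚP.+-identityʳ (f 0) ⟩
  f 0 ∎
  where open ≡-Reasoning
sum-indicator {suc n} (suc k) (s≤s k<n) f =
  trans (cong₂ ℚ._+_ (ℚP.*-zeroˡ (f 0)) (sum-indicator k k<n (f ∘ suc))) (ℚP.+-identityˡ (f (suc k)))

[∨]-split : ∀ {P Q : Set} (p : Dec P) (q : Dec Q) → ¬ (P × Q) → ∀ x →
  [ does p ∨ does q ] ℚ.* x ≡ [ does p ] ℚ.* x ℚ.+ [ does q ] ℚ.* x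
[∨]-split (yes P) (yes Q) ¬P×Q x = contradiction (P , Q) ¬P×Q
[∨]-split (yes _) (no _)  _    x = sym (trans (cong (1ℚ ℚ.* x ℚ.+_) (ℚP.*-zeroˡ x)) (ℚP.+-identityʳ _))
[∨]-split (no _)  (yes _) _    x = sym (trans (cong (ℚ._+ 1ℚ ℚ.* x) (ℚP.*-zeroˡ x)) (ℚP.+-identityˡ _))
[∨]-split (no _)  (no _)  _    x = sym (trans (cong (ℚ._+ 0ℚ ℚ.* x) (ℚP.*-zeroˡ x)) (ℚP.+-identityˡ _))

∣-negated : ∀ {d x y} → d ∣ x → - x ≡ y → d ∣ y
∣-negated d∣x refl = ∣m⇒∣-m d∣x

[x+y]-x≡y : ∀ x y → x + y - x ≡ y
[x+y]-x≡y = solve-∀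

∤-small : ∀ {m x} → 0 < ℤ.∣ x ∣ → ℤ.∣ x ∣ < m → ¬ (+ m ∣ x)
∤-small 0<∣x∣ ∣x∣<m m∣x = ℕD.>⇒∤ {{ℕ.>-nonZero 0<∣x∣}} ∣x∣<m (∣⇒∣ᵤ m∣x)

∤-± : ∀ {m n x} → 0 < n → n < m → x ≡ + n ⊎ x ≡ - + n → ¬ (+ m ∣ x)
∤-± 0<n n<m (inj₁ refl) = ∤-small 0<n n<m
∤-± {n = n} 0<n n<m (inj₂ refl) m∣-n =
  ∤-small 0<n n<m (∣-negated m∣-n (ℤP.neg-involutive (+ n)))

congruent-residues-equal : ∀ {m r s} → r < m → s < m → + m ∣ + r - + s → r ≡ s
congruent-residues-equal {m} {r} {s} r<m s<m m∣r-s with ℤ.∣ + r - + s ∣ in ∣r-s∣≡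
... | zero  = ℤP.+-injective (ℤP.i-j≡0⇒i≡j (+ r) (+ s) (ℤP.∣i∣≡0⇒i≡0 ∣r-s∣≡))
... | suc _ = contradiction m∣r-s (∤-small (subst (0 <_) (sym ∣r-s∣≡) (s≤s z≤n)) ∣r-s∣<m)
  where
  ∣r-s∣<m : ℤ.∣ + r - + s ∣ < m
  ∣r-s∣<m = subst (_< m) (cong ℤ.∣_∣ (sym (ℤP.m-n≡m⊖n r s)))
              (ℕP.≤-<-trans (ℤP.∣m⊝n∣≤m⊔n r s) (ℕP.⊔-lub r<m s<m))

m∣y-y%m : ∀ y m .{{_ : NonZero m}} → + m ∣ y - + (y %ℕ m)
m∣y-y%m y m = divides (y /ℕ m) (begin
  y - + (y %ℕ m)                            ≡⟨ cong (_- + (y %ℕ m)) (a≡a%ℕn+[a/ℕn]*n y m) ⟩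
  + (y %ℕ m) + y /ℕ m ℤ.* + m - + (y %ℕ m)  ≡⟨ [x+y]-x≡y (+ (y %ℕ m)) (y /ℕ m ℤ.* + m) ⟩
  y /ℕ m ℤ.* + m                            ∎)
  where open ≡-Reasoning

y%m≡j⇔m∣y-j : ∀ y {m j} .{{_ : NonZero m}} → j < m → (y %ℕ m ≡ j) ⇔ (+ m ∣ y - + j)
y%m≡j⇔m∣y-j y {m} {j} j<m = mk⇔
  (λ y%m≡j → subst (λ r → + m ∣ y - + r) y%m≡j (m∣y-y%m y m))
  (λ m∣y-j → congruent-residues-equal (n%ℕd<d y m) j<m
     (subst (+ m ∣_) (rearrange y (+ (y %ℕ m)) (+ j)) (∣m∣n⇒∣m-n m∣y-j (m∣y-y%m y m))))
  where
  rearrange : ∀ y r j → (y - j) - (y - r) ≡ r - j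
  rearrange = solve-∀

%ℕ≟-as-∣? : ∀ y {m j} .{{_ : NonZero m}} → j < m → does (y %ℕ m ℕ.≟ j) ≡ does (+ m ∣? y - + j)
%ℕ≟-as-∣? y {m} {j} j<m = does-⇔ (y%m≡j⇔m∣y-j y j<m) (y %ℕ m ℕ.≟ j) (+ m ∣? y - + j)

[mod]-as-∣? : ∀ {m} .{{_ : NonZero m}} i k {j} → j < m →
  (j ≡ i + k [mod m ]) ≡ does (+ m ∣? (+ i + + k) - + j)
-- (+ i + + k) %ℕ m computes to (i + k) % m, the residue tested by the adjacency relation.
[mod]-as-∣? i k j<m = %ℕ≟-as-∣? (+ i + + k) j<m

[mod]-as-∣?-reversed : ∀ {m} .{{_ : NonZero m}} {i} j k → i < m →
  (i ≡ j + k [mod m ]) ≡ does (+ m ∣? (+ i - + k) - + j)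
[mod]-as-∣?-reversed {m} {i} j k i<m = trans (%ℕ≟-as-∣? (+ j + + k) i<m)
  (does-⇔ (mk⇔ (λ p → ∣-negated p (flip (+ i) (+ j) (+ k)))
                (λ p → ∣-negated p (flip′ (+ i) (+ j) (+ k))))
          (+ m ∣? + j + + k - + i) (+ m ∣? + i - + k - + j))
  where
  flip : ∀ i j k → - (j + k - i) ≡ i - k - j
  flip = solve-∀
  flip′ : ∀ i j k → - (i - k - j) ≡ j + k - i
  flip′ = solve-∀

Periodic : ℕ → (ℤ → ℚ) → Set
Periodic m F = ∀ y z → + m ∣ y - z → F y ≡ F z

module _ {m} .{{_ : NonZero m}} {F : ℤ → ℚ} (F-periodic : Periodic m F) where

  sum-residue : ∀ y → sum {m} (λ j → [ does (+ m ∣? y - + toℕ j) ] ℚ.* F (+ toℕ j)) ≡ F y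
  sum-residue y = begin
    sum {m} (λ j → [ does (+ m ∣? y - + toℕ j) ] ℚ.* F (+ toℕ j))
      ≡⟨ sum-cong-≗ (λ j → cong (λ b → [ b ] ℚ.* F (+ toℕ j)) (sym (%ℕ≟-as-∣? y (FP.toℕ<n j)))) ⟩
    sum {m} (λ j → [ does (y %ℕ m ℕ.≟ toℕ j) ] ℚ.* F (+ toℕ j))
      ≡⟨ sum-indicator (y %ℕ m) (n%ℕd<d y m) (F ∘ +_) ⟩
    F (+ (y %ℕ m))
      ≡⟨ F-periodic y (+ (y %ℕ m)) (m∣y-y%m y m) ⟨
    F y ∎
    where open ≡-Reasoning

  sum-two-residues : ∀ {p q : Fin m → Bool} y z →
    (∀ j → p j ≡ does (+ m ∣? y - + toℕ j)) → (∀ j → q j ≡ does (+ m ∣? z - + toℕ j)) →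
    ¬ (+ m ∣ y - z) → sum {m} (λ j → [ p j ∨ q j ] ℚ.* F (+ toℕ j)) ≡ F y ℚ.+ F z
  sum-two-residues {p} {q} y z p≡ q≡ m∤y-z = begin
    sum {m} (λ j → [ p j ∨ q j ] ℚ.* F (+ toℕ j))
      ≡⟨ sum-cong-≗ (λ j → trans (cong₂ (λ s t → [ s ∨ t ] ℚ.* F (+ toℕ j)) (p≡ j) (q≡ j))
                                 ([∨]-split (y ≋? j) (z ≋? j) (not-both j) (F (+ toℕ j)))) ⟩
    sum {m} (λ j → weighted y j ℚ.+ weighted z j)
      ≡⟨ ∑-distrib-+ (weighted y) (weighted z) ⟩
    sum (weighted y) ℚ.+ sum (weighted z)
      ≡⟨ cong₂ ℚ._+_ (sum-residue y) (sum-residue z) ⟩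
    F y ℚ.+ F z ∎
    where
    open ≡-Reasoning
    _≋?_ : ∀ x (j : Fin m) → Dec (+ m ∣ x - + toℕ j)
    x ≋? j = + m ∣? x - + toℕ j
    weighted : ℤ → Fin m → ℚ
    weighted x j = [ does (x ≋? j) ] ℚ.* F (+ toℕ j)
    cancel : ∀ y z j → (y - j) - (z - j) ≡ y - z
    cancel = solve-∀
    not-both : ∀ j → ¬ (+ m ∣ y - + toℕ j × + m ∣ z - + toℕ j)
    not-both j (m∣y-j , m∣z-j) = m∤y-z (subst (+ m ∣_) (cancel y z (+ toℕ j)) (∣m∣n⇒∣m-n m∣y-j m∣z-j))

cyclesVector : ∀ m → (ℤ → ℚ) → (ℤ → ℚ) → Fin (m ℕ.+ m) → ℚ
cyclesVector m V W w = [ V ∘ +_ ∘ toℕ , W ∘ +_ ∘ toℕ ]′ (F.splitAt m w)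

cyclesVector-x : ∀ {m k} V W (k<m : k < m) → cyclesVector m V W (F.fromℕ< k<m ↑ˡ m) ≡ V (+ k)
cyclesVector-x {m} V W k<m =
  trans (cong [ V ∘ +_ ∘ toℕ , W ∘ +_ ∘ toℕ ]′ (FP.splitAt-↑ˡ m (F.fromℕ< k<m) m))
        (cong (V ∘ +_) (FP.toℕ-fromℕ< k<m))

cyclesVector-y : ∀ {m k} V W (k<m : k < m) → cyclesVector m V W (m ↑ʳ F.fromℕ< k<m) ≡ W (+ k)
cyclesVector-y {m} V W k<m =
  trans (cong [ V ∘ +_ ∘ toℕ , W ∘ +_ ∘ toℕ ]′ (FP.splitAt-↑ʳ m m (F.fromℕ< k<m)))
        (cong (W ∘ +_) (FP.toℕ-fromℕ< k<m))

-- The bounds on a, b, c make the two neighbours of each vertex on either side distinct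
-- modulo m, so that every row of the adjacency matrix picks up two values of V and two of W.
module _ {m a b c} .{{_ : NonZero m}}
  (0<a : 0 < a) (2a<m : a ℕ.+ a < m) (0<b : 0 < b) (2b<m : b ℕ.+ b < m) (0<c : 0 < c) (c<m : c < m)
  {V W : ℤ → ℚ} (V-periodic : Periodic m V) (W-periodic : Periodic m W)
  (x-rows : ∀ i → V (i + + a) ℚ.+ V (i - + a) ℚ.+ (W i ℚ.+ W (i + + c)) ≡ 0ℚ)
  (y-rows : ∀ i → V i ℚ.+ V (i - + c) ℚ.+ (W (i + + b) ℚ.+ W (i - + b)) ≡ 0ℚ)
  where

  private
    spread : ∀ i a → (i + a) - (i - a) ≡ a + a
    spread = solve-∀
    shift-back : ∀ i c → (i + + 0) - (i + c) ≡ - c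
    shift-back = solve-∀
    shift-forward : ∀ i c → (i - + 0) - (i - c) ≡ c
    shift-forward = solve-∀

    row : ∀ s → sum {m} (λ j → [ B2adj m a b c s (inj₁ j) ] ℚ.* V (+ toℕ j))
            ℚ.+ sum {m} (λ j → [ B2adj m a b c s (inj₂ j) ] ℚ.* W (+ toℕ j)) ≡ 0ℚ
    row (inj₁ i) =
      trans (cong₂ ℚ._+_ xx (trans xy (cong (λ t → W t ℚ.+ W (ι + + c)) (ℤP.+-identityʳ ι)))) (x-rows ι)
      where
      ι : ℤ
      ι = + toℕ i
      xx : sum {m} (λ j → [ B2adj m a b c (inj₁ i) (inj₁ j) ] ℚ.* V (+ toℕ j))
             ≡ V (ι + + a) ℚ.+ V (ι - + a)
      xx = sum-two-residues V-periodic (ι + + a) (ι - + a)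
             (λ j → [mod]-as-∣? (toℕ i) a (FP.toℕ<n j))
             (λ j → [mod]-as-∣?-reversed (toℕ j) a (FP.toℕ<n i))
             (∤-± (ℕP.<-≤-trans 0<a (ℕP.m≤m+n a a)) 2a<m (inj₁ (spread ι (+ a))))
      xy : sum {m} (λ j → [ B2adj m a b c (inj₁ i) (inj₂ j) ] ℚ.* W (+ toℕ j))
             ≡ W (ι + + 0) ℚ.+ W (ι + + c)
      xy = sum-two-residues W-periodic (ι + + 0) (ι + + c)
             (λ j → [mod]-as-∣? (toℕ i) 0 (FP.toℕ<n j)) (λ j → [mod]-as-∣? (toℕ i) c (FP.toℕ<n j))
             (∤-± 0<c c<m (inj₂ (shift-back ι (+ c))))
    row (inj₂ i) =
      trans (cong₂ ℚ._+_ (trans yx (cong (λ t → V t ℚ.+ V (ι - + c)) (ℤP.+-identityʳ ι))) yy) (y-rows ι)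
      where
      ι : ℤ
      ι = + toℕ i
      yx : sum {m} (λ j → [ B2adj m a b c (inj₂ i) (inj₁ j) ] ℚ.* V (+ toℕ j))
             ≡ V (ι - + 0) ℚ.+ V (ι - + c)
      yx = sum-two-residues V-periodic (ι - + 0) (ι - + c)
             (λ j → [mod]-as-∣?-reversed (toℕ j) 0 (FP.toℕ<n i))
             (λ j → [mod]-as-∣?-reversed (toℕ j) c (FP.toℕ<n i))
             (∤-± 0<c c<m (inj₁ (shift-forward ι (+ c))))
      yy : sum {m} (λ j → [ B2adj m a b c (inj₂ i) (inj₂ j) ] ℚ.* W (+ toℕ j))
             ≡ W (ι + + b) ℚ.+ W (ι - + b)
      yy = sum-two-residues W-periodic (ι + + b) (ι - + b)
             (λ j → [mod]-as-∣? (toℕ i) b (FP.toℕ<n j))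
             (λ j → [mod]-as-∣?-reversed (toℕ j) b (FP.toℕ<n i))
             (∤-± (ℕP.<-≤-trans 0<b (ℕP.m≤m+n b b)) 2b<m (inj₁ (spread ι (+ b))))

  B2-kernel : InKernel (B2 m a b c) (cyclesVector m V W)
  B2-kernel u = begin
    Σℚ (m ℕ.+ m) (λ w → [ B2 m a b c u w ] ℚ.* cyclesVector m V W w)
      ≡⟨ Σℚ≡sum (m ℕ.+ m) _ ⟩
    sum (λ w → [ B2 m a b c u w ] ℚ.* cyclesVector m V W w)
      ≡⟨ sum-↑ˡ-↑ʳ m _ ⟩
    sum {m} (λ j → [ B2 m a b c u (j ↑ˡ m) ] ℚ.* cyclesVector m V W (j ↑ˡ m))
      ℚ.+ sum {m} (λ j → [ B2 m a b c u (m ↑ʳ j) ] ℚ.* cyclesVector m V W (m ↑ʳ j))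
      ≡⟨ cong₂ ℚ._+_ (sum-cong-≗ (λ j → on-split (FP.splitAt-↑ˡ m j m)))
                     (sum-cong-≗ (λ j → on-split (FP.splitAt-↑ʳ m m j))) ⟩
    _ ≡⟨ row (F.splitAt m u) ⟩
    0ℚ ∎
    where
    open ≡-Reasoning
    on-split : ∀ {w t} → F.splitAt m w ≡ t →
      [ B2 m a b c u w ] ℚ.* cyclesVector m V W w
        ≡ [ B2adj m a b c (F.splitAt m u) t ] ℚ.* [ V ∘ +_ ∘ toℕ , W ∘ +_ ∘ toℕ ]′ t
    on-split refl = refl

kernel-vector-with-zero-entry⇒¬IsNut : ∀ {n} (G : Graph n) {w} → InKernel G w →
  ∀ u₀ u₁ → w u₀ ≡ 0ℚ → w u₁ ≢ 0ℚ → ¬ IsNut G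
kernel-vector-with-zero-entry⇒¬IsNut G {w} w∈ker u₀ u₁ w₀≡0 w₁≢0 (v , _ , v≢0 , spans)
  with spans w w∈ker
... | t , w≡tv with t ℚ.≟ 0ℚ
...   | yes refl = w₁≢0 (trans (w≡tv u₁) (ℚP.*-zeroˡ (v u₁)))
...   | no  t≢0  = v≢0 u₀ (begin
  v u₀                     ≡⟨ ℚP.*-identityˡ (v u₀) ⟨
  1ℚ ℚ.* v u₀              ≡⟨ cong (ℚ._* v u₀) (ℚP.*-inverseˡ t) ⟨
  ℚ.1/ t ℚ.* t ℚ.* v u₀    ≡⟨ ℚP.*-assoc (ℚ.1/ t) t (v u₀) ⟩
  ℚ.1/ t ℚ.* (t ℚ.* v u₀)  ≡⟨ cong (ℚ.1/ t ℚ.*_) (trans (sym (w≡tv u₀)) w₀≡0) ⟩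
  ℚ.1/ t ℚ.* 0ℚ            ≡⟨ ℚP.*-zeroʳ (ℚ.1/ t) ⟩
  0ℚ                       ∎)
  where
  open ≡-Reasoning
  instance
    t-nonZero : ℚ.NonZero t
    t-nonZero = ℚ.≢-nonZero t≢0

𝟙[_∣_] : ℕ → ℤ → ℚ
𝟙[ d ∣ y ] = [ does (+ d ∣? y) ]

𝟙∣-cong : ∀ {d} y z → + d ∣ y - z → 𝟙[ d ∣ y ] ≡ 𝟙[ d ∣ z ]
𝟙∣-cong {d} y z d∣y-z = cong [_] (does-⇔ (mk⇔ to from) (+ d ∣? y) (+ d ∣? z))
  where
  y-[y-z]≡z : ∀ y z → y - (y - z) ≡ z
  y-[y-z]≡z = solve-∀
  z+[y-z]≡y : ∀ y z → z + (y - z) ≡ y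
  z+[y-z]≡y = solve-∀
  to : + d ∣ y → + d ∣ z
  to d∣y = subst (+ d ∣_) (y-[y-z]≡z y z) (∣m∣n⇒∣m-n d∣y d∣y-z)
  from : + d ∣ z → + d ∣ y
  from d∣z = subst (+ d ∣_) (z+[y-z]≡y y z) (∣m∣n⇒∣m+n d∣z d∣y-z)

𝟙∣-periodic : ∀ {m d} → + d ∣ + m → Periodic m 𝟙[ d ∣_]
𝟙∣-periodic d∣m y z m∣y-z = 𝟙∣-cong y z (∣-trans d∣m m∣y-z)

shift-periodic : ∀ {m F} s → Periodic m F → Periodic m (λ y → F (y + s))
shift-periodic {m} s F-periodic y z m∣y-z =
  F-periodic (y + s) (z + s) (subst (+ m ∣_) (shift y z s) m∣y-z)
  where
  shift : ∀ y z s → y - z ≡ (y + s) - (z + s)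
  shift = solve-∀

±-symmetric : ∀ (F : ℤ → ℚ) {s x} → s ≡ x ⊎ s ≡ - x → ∀ i →
  F (i + x) ℚ.+ F (i - x) ≡ F (i + s) ℚ.+ F (i - s)
±-symmetric F (inj₁ refl) i = refl
±-symmetric F {x = x} (inj₂ refl) i = trans (ℚP.+-comm (F (i + x)) (F (i - x)))
  (cong (λ u → F (i - x) ℚ.+ F (i + u)) (sym (ℤP.neg-involutive x)))

cancel-pairs : ∀ {p q p′ q′} → p ≡ p′ → q ≡ q′ → p ℚ.+ q ℚ.+ (ℚ.- p′ ℚ.+ ℚ.- q′) ≡ 0ℚ
cancel-pairs {p} {q} refl refl =
  trans (cong (p ℚ.+ q ℚ.+_) (sym (ℚP.neg-distrib-+ p q))) (ℚP.+-inverseʳ (p ℚ.+ q))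

cancel-crossed-pairs : ∀ {p q p′ q′} → p ≡ q′ → q ≡ p′ → p ℚ.+ q ℚ.+ (ℚ.- p′ ℚ.+ ℚ.- q′) ≡ 0ℚ
cancel-crossed-pairs {p} {q} p≡q′ q≡p′ = trans (cong (ℚ._+ _) (ℚP.+-comm p q)) (cancel-pairs q≡p′ p≡q′)

alternating : ℕ → ℤ → ℚ
alternating T y = 𝟙[ 2 * T ∣ y ] ℚ.- 𝟙[ 2 * T ∣ y - + T ]

alternating-periodic : ∀ {m} T → + (2 * T) ∣ + m → Periodic m (alternating T)
alternating-periodic T 2T∣m y z m∣y-z =
  cong₂ ℚ._-_ (𝟙∣-periodic 2T∣m y z m∣y-z) (shift-periodic (- + T) (𝟙∣-periodic 2T∣m) y z m∣y-z)

alternating-antiperiodic : ∀ T y z → + (2 * T) ∣ y - z - + T → alternating T y ℚ.+ alternating T z ≡ 0ℚ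
alternating-antiperiodic T y z 2T∣y-z-T = begin
  𝟙[ 2 * T ∣ y ] ℚ.- 𝟙[ 2 * T ∣ y - + T ] ℚ.+ (𝟙[ 2 * T ∣ z ] ℚ.- 𝟙[ 2 * T ∣ z - + T ])
    ≡⟨ cong₂ (λ p q → p ℚ.- q ℚ.+ (𝟙[ 2 * T ∣ z ] ℚ.- 𝟙[ 2 * T ∣ z - + T ]))
             (𝟙∣-cong y (z - + T)
               (subst (+ (2 * T) ∣_) (add-period y z (+ T)) (∣m∣n⇒∣m+n 2T∣y-z-T 2T∣T+T)))
             (𝟙∣-cong (y - + T) z (subst (+ (2 * T) ∣_) (reorder y z (+ T)) 2T∣y-z-T)) ⟩
  𝟙[ 2 * T ∣ z - + T ] ℚ.- 𝟙[ 2 * T ∣ z ] ℚ.+ (𝟙[ 2 * T ∣ z ] ℚ.- 𝟙[ 2 * T ∣ z - + T ])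
    ≡⟨ opposite 𝟙[ 2 * T ∣ z - + T ] 𝟙[ 2 * T ∣ z ] ⟩
  0ℚ ∎
  where
  open ≡-Reasoning
  2T∣T+T : + (2 * T) ∣ + T + + T
  2T∣T+T = subst (λ u → + (2 * T) ∣ + (T ℕ.+ u)) (ℕP.+-identityʳ T) ∣-refl
  add-period : ∀ y z T → y - z - T + (T + T) ≡ y - (z - T)
  add-period = solve-∀
  reorder : ∀ y z T → y - z - T ≡ (y - T) - z
  reorder = solve-∀
  opposite : ∀ p q → p ℚ.- q ℚ.+ (q ℚ.- p) ≡ 0ℚ
  opposite = +-*-Solver.solve 2 (λ p q → (p :- q) :+ (q :- p) := con 0ℚ) refl
    where open +-*-Solver

alternating-at-0 : ∀ {T} → 0 < T → alternating T 0ℤ ≡ 1ℚ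
alternating-at-0 {T} 0<T = cong₂ (λ p q → [ p ] ℚ.- [ q ])
  (dec-true (+ (2 * T) ∣? 0ℤ) (divides 0ℤ refl))
  (dec-false (+ (2 * T) ∣? 0ℤ - + T) (∤-± 0<T T<2T (inj₂ (ℤP.+-identityˡ (- + T)))))
  where
  T<2T : T < 2 * T
  T<2T = ℕP.m<m+n T (ℕP.<-≤-trans 0<T (ℕP.m≤m+n T 0))

v2aux-odd-part : ∀ f n → 0 < n → n ≤ f → ∃[ r ] n ≡ 2 ^ v2aux f n * (1 ℕ.+ 2 * r)
v2aux-odd-part (suc f) (suc n) _ (s≤s n≤f) with suc n % 2 in parity
... | zero = r , (begin
  suc n                           ≡⟨ halving ⟩
  2 * h                           ≡⟨ cong (2 *_) h≡ ⟩
  2 * (2 ^ k * (1 ℕ.+ 2 * r))     ≡⟨ ℕP.*-assoc 2 (2 ^ k) (1 ℕ.+ 2 * r) ⟨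
  2 ^ suc k * (1 ℕ.+ 2 * r)       ∎)
  where
  open ≡-Reasoning
  h : ℕ
  h = suc n / 2
  k : ℕ
  k = v2aux f h
  halving : suc n ≡ 2 * h
  halving = trans (m≡m%n+[m/n]*n (suc n) 2) (trans (cong (ℕ._+ h * 2) parity) (ℕP.*-comm h 2))
  0<h : 0 < h
  0<h = ℕP.n≢0⇒n>0 (λ h≡0 → ℕP.1+n≢0 (trans halving (cong (2 *_) h≡0)))
  h≤f : h ≤ f
  h≤f = ℕP.≤-trans (ℕP.<⇒≤pred (m/n<m (suc n) 2 (s≤s (s≤s z≤n)))) n≤f
  r : ℕ
  r = proj₁ (v2aux-odd-part f h 0<h h≤f)
  h≡ : h ≡ 2 ^ k * (1 ℕ.+ 2 * r)
  h≡ = proj₂ (v2aux-odd-part f h 0<h h≤f)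
... | suc zero = suc n / 2 , (begin
  suc n                              ≡⟨ m≡m%n+[m/n]*n (suc n) 2 ⟩
  suc n % 2 ℕ.+ suc n / 2 * 2        ≡⟨ cong (ℕ._+ suc n / 2 * 2) parity ⟩
  1 ℕ.+ suc n / 2 * 2                ≡⟨ cong suc (ℕP.*-comm (suc n / 2) 2) ⟩
  1 ℕ.+ 2 * (suc n / 2)              ≡⟨ ℕP.*-identityˡ (1 ℕ.+ 2 * (suc n / 2)) ⟨
  1 * (1 ℕ.+ 2 * (suc n / 2))        ∎)
  where open ≡-Reasoning
... | suc (suc _) = contradiction (subst (_< 2) parity (m%n<n (suc n) 2)) λ { (s≤s (s≤s ())) }

v2-odd-part : ∀ {n} → 0 < n → ∃[ r ] n ≡ 2 ^ v2 n * (1 ℕ.+ 2 * r)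
v2-odd-part {n} 0<n = v2aux-odd-part n n 0<n ℕP.≤-refl

∣-odd-multiple : ∀ {n} T r → n ≡ T * (1 ℕ.+ 2 * r) → + (2 * T) ∣ + n - + T
∣-odd-multiple T r refl = divides (+ r) (begin
  + (T * (1 ℕ.+ 2 * r)) - + T      ≡⟨ cong (λ u → + u - + T) (expand T r) ⟩
  + T + + (r * (2 * T)) - + T      ≡⟨ cong (λ u → + T + u - + T) (ℤP.pos-* r (2 * T)) ⟩
  + T + + r ℤ.* + (2 * T) - + T    ≡⟨ [x+y]-x≡y (+ T) (+ r ℤ.* + (2 * T)) ⟩
  + r ℤ.* + (2 * T)                ∎)
  where
  open ≡-Reasoning
  expand : ∀ T r → T * (1 ℕ.+ 2 * r) ≡ T ℕ.+ r * (2 * T)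
  expand = ℕSolver.solve-∀

2^v2-residue : ∀ {n} → 0 < n → + (2 * 2 ^ v2 n) ∣ + n - + 2 ^ v2 n
2^v2-residue {n} 0<n = ∣-odd-multiple (2 ^ v2 n) (proj₁ (v2-odd-part 0<n)) (proj₂ (v2-odd-part 0<n))

2^v2-residue-of-double : ∀ {n k} → 0 < n → suc (v2 n) ≡ k → + (2 * 2 ^ k) ∣ + n + + n - + 2 ^ k
2^v2-residue-of-double {n} 0<n refl = ∣-odd-multiple (2 ^ suc (v2 n)) r (begin
  n ℕ.+ n                           ≡⟨ cong (n ℕ.+_) (ℕP.+-identityʳ n) ⟨
  2 * n                             ≡⟨ cong (2 *_) n≡ ⟩
  2 * (2 ^ v2 n * (1 ℕ.+ 2 * r))    ≡⟨ ℕP.*-assoc 2 (2 ^ v2 n) (1 ℕ.+ 2 * r) ⟨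
  2 ^ suc (v2 n) * (1 ℕ.+ 2 * r)    ∎)
  where
  open ≡-Reasoning
  r : ℕ
  r = proj₁ (v2-odd-part 0<n)
  n≡ : n ≡ 2 ^ v2 n * (1 ℕ.+ 2 * r)
  n≡ = proj₂ (v2-odd-part 0<n)

2^k∣n : ∀ {n k} → 0 < n → k ≤ v2 n → + 2 ^ k ∣ + n
2^k∣n {n} {k} 0<n k≤v2n = ∣ᵤ⇒∣ (subst (2 ^ k ℕD.∣_) (sym (proj₂ (v2-odd-part 0<n)))
  (ℕD.∣m⇒∣m*n _ (subst (2 ^ k ℕD.∣_) split (ℕD.m∣m*n (2 ^ (v2 n ℕ.∸ k))))))
  where
  split : 2 ^ k * 2 ^ (v2 n ℕ.∸ k) ≡ 2 ^ v2 n
  split = trans (sym (ℕP.^-distribˡ-+-* 2 k (v2 n ℕ.∸ k))) (cong (2 ^_) (ℕP.m+[n∸m]≡n k≤v2n))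

coprime-to-gcd : ∀ {m} .{{_ : NonZero m}} x y →
  (∀ {d} → 2 ≤ d → + d ∣ + m → + d ∣ x → + d ∣ y → ⊥) → Coprime m (gcdℤ x y)
coprime-to-gcd {m} x y _ {zero} (0∣m , _) = contradiction (ℕD.0∣⇒≡0 0∣m) (ℕ.≢-nonZero⁻¹ m)
coprime-to-gcd x y _ {1} _ = refl
coprime-to-gcd x y no-common-divisor {suc (suc _)} (d∣m , d∣gcd) = contradiction
  (∣ᵤ⇒∣ (ℕD.∣-trans d∣gcd (gcd[m,n]∣n ℤ.∣ x ∣ ℤ.∣ y ∣)))
  (no-common-divisor (s≤s (s≤s z≤n)) (∣ᵤ⇒∣ d∣m) (∣ᵤ⇒∣ (ℕD.∣-trans d∣gcd (gcd[m,n]∣m ℤ.∣ x ∣ ℤ.∣ y ∣))))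

module _ {m a b c} .{{_ : NonZero m}}
  (0<a : 0 < a) (2a<m : a ℕ.+ a < m) (0<b : 0 < b) (2b<m : b ℕ.+ b < m) (0<c : 0 < c) (c<m : c < m)
  where

  private
    1<m : 1 < m
    1<m = ℕP.≤-trans (ℕP.+-mono-≤ 0<a 0<a) (ℕP.<⇒≤ 2a<m)
    0<m : 0 < m
    0<m = ℕP.<⇒≤ 1<m

  divisor-obstruction : ∀ {d s t} → 2 ≤ d → + d ∣ + m → s ≡ + a ⊎ s ≡ - + a → t ≡ + b ⊎ t ≡ - + b →
    + d ∣ s - t → + d ∣ s + t + + c → ¬ IsNut (B2 m a b c)
  divisor-obstruction {d} {s} {t} 2≤d d∣m s≡±a t≡±b d∣s-t d∣s+t+c =
    kernel-vector-with-zero-entry⇒¬IsNut (B2 m a b c) kernel (F.fromℕ< 1<m ↑ˡ m) (F.fromℕ< 0<m ↑ˡ m)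
      (trans (cyclesVector-x V W 1<m) (cong [_] (dec-false (+ d ∣? + 1) d∤1)))
      (λ x₀≡0 → ℚP.1≢0 (trans (sym x₀≡1) x₀≡0))
    where
    V W : ℤ → ℚ
    V y = 𝟙[ d ∣ y ]
    W y = ℚ.- 𝟙[ d ∣ y + s ]
    d∤1 : ¬ (+ d ∣ + 1)
    d∤1 d∣1 = ℕP.<⇒≱ 2≤d (ℕD.∣⇒≤ (∣⇒∣ᵤ d∣1))
    x₀≡1 : cyclesVector m V W (F.fromℕ< 0<m ↑ˡ m) ≡ 1ℚ
    x₀≡1 = trans (cyclesVector-x V W 0<m) (cong [_] (dec-true (+ d ∣? 0ℤ) (divides 0ℤ refl)))
    x-shift : ∀ i s t c → - ((s - t) + (s + t + c)) ≡ (i - s) - (i + c + s)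
    x-shift = solve-∀
    y-shift₁ : ∀ i s t → - (s - t) ≡ i - (i - t + s)
    y-shift₁ = solve-∀
    y-shift₂ : ∀ i s t c → - (s + t + c) ≡ (i - c) - (i + t + s)
    y-shift₂ = solve-∀
    x-rows : ∀ i → V (i + + a) ℚ.+ V (i - + a) ℚ.+ (W i ℚ.+ W (i + + c)) ≡ 0ℚ
    x-rows i = trans (cong (ℚ._+ (W i ℚ.+ W (i + + c))) (±-symmetric V s≡±a i))
      (cancel-pairs {p = V (i + s)} refl (𝟙∣-cong (i - s) (i + + c + s)
        (∣-negated (∣m∣n⇒∣m+n d∣s-t d∣s+t+c) (x-shift i s t (+ c)))))
    y-rows : ∀ i → V i ℚ.+ V (i - + c) ℚ.+ (W (i + + b) ℚ.+ W (i - + b)) ≡ 0ℚ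
    y-rows i = trans (cong (V i ℚ.+ V (i - + c) ℚ.+_) (±-symmetric W t≡±b i))
      (cancel-crossed-pairs (𝟙∣-cong i (i - t + s) (∣-negated d∣s-t (y-shift₁ i s t)))
                            (𝟙∣-cong (i - + c) (i + t + s) (∣-negated d∣s+t+c (y-shift₂ i s t (+ c)))))
    kernel : InKernel (B2 m a b c) (cyclesVector m V W)
    kernel = B2-kernel 0<a 2a<m 0<b 2b<m 0<c c<m (𝟙∣-periodic d∣m)
      (λ y z m∣y-z → cong ℚ.-_ (shift-periodic s (𝟙∣-periodic d∣m) y z m∣y-z)) x-rows y-rows

  alternating-obstructionˣ : ∀ {T} → 0 < T → + (2 * T) ∣ + m →
    + (2 * T) ∣ + a + + a - + T → + (2 * T) ∣ + c - + T → ¬ IsNut (B2 m a b c)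
  alternating-obstructionˣ {T} 0<T 2T∣m 2T∣2a-T 2T∣c-T =
    kernel-vector-with-zero-entry⇒¬IsNut (B2 m a b c) kernel (m ↑ʳ F.fromℕ< 0<m) (F.fromℕ< 0<m ↑ˡ m)
      (cyclesVector-y V W 0<m) (λ x₀≡0 → ℚP.1≢0 (trans (sym x₀≡1) x₀≡0))
    where
    V W : ℤ → ℚ
    V = alternating T
    W _ = 0ℚ
    x₀≡1 : cyclesVector m V W (F.fromℕ< 0<m ↑ˡ m) ≡ 1ℚ
    x₀≡1 = trans (cyclesVector-x V W 0<m) (alternating-at-0 0<T)
    x-shift : ∀ i a T → a + a - T ≡ (i + a) - (i - a) - T
    x-shift = solve-∀
    y-shift : ∀ i c T → c - T ≡ i - (i - c) - T
    y-shift = solve-∀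
    kernel : InKernel (B2 m a b c) (cyclesVector m V W)
    kernel = B2-kernel 0<a 2a<m 0<b 2b<m 0<c c<m {W = W} (alternating-periodic T 2T∣m) (λ _ _ _ → refl)
      (λ i → trans (ℚP.+-identityʳ _) (alternating-antiperiodic T (i + + a) (i - + a)
        (subst (+ (2 * T) ∣_) (x-shift i (+ a) (+ T)) 2T∣2a-T)))
      (λ i → trans (ℚP.+-identityʳ _) (alternating-antiperiodic T i (i - + c)
        (subst (+ (2 * T) ∣_) (y-shift i (+ c) (+ T)) 2T∣c-T)))

  alternating-obstructionʸ : ∀ {T} → 0 < T → + (2 * T) ∣ + m →
    + (2 * T) ∣ + b + + b - + T → + (2 * T) ∣ + c - + T → ¬ IsNut (B2 m a b c)
  alternating-obstructionʸ {T} 0<T 2T∣m 2T∣2b-T 2T∣c-T =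
    kernel-vector-with-zero-entry⇒¬IsNut (B2 m a b c) kernel (F.fromℕ< 0<m ↑ˡ m) (m ↑ʳ F.fromℕ< 0<m)
      (cyclesVector-x V W 0<m) (λ y₀≡0 → ℚP.1≢0 (trans (sym y₀≡1) y₀≡0))
    where
    V W : ℤ → ℚ
    V _ = 0ℚ
    W = alternating T
    y₀≡1 : cyclesVector m V W (m ↑ʳ F.fromℕ< 0<m) ≡ 1ℚ
    y₀≡1 = trans (cyclesVector-y V W 0<m) (alternating-at-0 0<T)
    x-shift : ∀ i c T → c - T ≡ (i + c) - i - T
    x-shift = solve-∀
    y-shift : ∀ i b T → b + b - T ≡ (i + b) - (i - b) - T
    y-shift = solve-∀
    kernel : InKernel (B2 m a b c) (cyclesVector m V W)
    kernel = B2-kernel 0<a 2a<m 0<b 2b<m 0<c c<m {V = V} (λ _ _ _ → refl) (alternating-periodic T 2T∣m)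
      (λ i → trans (ℚP.+-identityˡ _) (trans (ℚP.+-comm (W i) (W (i + + c)))
        (alternating-antiperiodic T (i + + c) i (subst (+ (2 * T) ∣_) (x-shift i (+ c) (+ T)) 2T∣c-T))))
      (λ i → trans (ℚP.+-identityˡ _) (alternating-antiperiodic T (i + + b) (i - + b)
        (subst (+ (2 * T) ∣_) (y-shift i (+ b) (+ T)) 2T∣2b-T)))

  coprimality-conditions : IsNut (B2 m a b c) →
      Coprime m (gcdℤ (+ a ℤ.- + b) (+ a ℤ.+ + b ℤ.+ + c))
    × Coprime m (gcdℤ (+ a ℤ.- + b) (+ a ℤ.+ + b ℤ.- + c))
    × Coprime m (gcdℤ (+ a ℤ.+ + b) (+ a ℤ.- + b ℤ.+ + c))
    × Coprime m (gcdℤ (+ a ℤ.+ + b) (+ a ℤ.- + b ℤ.- + c))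
  coprimality-conditions nut =
      coprime-to-gcd _ _ (λ 2≤d d∣m d∣x d∣y →
        divisor-obstruction 2≤d d∣m (inj₁ refl) (inj₁ refl) d∣x d∣y nut)
    , coprime-to-gcd _ _ (λ 2≤d d∣m d∣x d∣y →
        divisor-obstruction 2≤d d∣m (inj₂ refl) (inj₂ refl)
          (∣-negated d∣x (neg₁ (+ a) (+ b))) (∣-negated d∣y (neg₂ (+ a) (+ b) (+ c))) nut)
    , coprime-to-gcd _ _ (λ 2≤d d∣m d∣x d∣y →
        divisor-obstruction 2≤d d∣m (inj₁ refl) (inj₂ refl)
          (subst (_ ∣_) (cong (_+_ (+ a)) (sym (ℤP.neg-involutive (+ b)))) d∣x) d∣y nut)
    , coprime-to-gcd _ _ (λ 2≤d d∣m d∣x d∣y →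
        divisor-obstruction 2≤d d∣m (inj₂ refl) (inj₁ refl)
          (∣-negated d∣x (neg₃ (+ a) (+ b))) (∣-negated d∣y (neg₄ (+ a) (+ b) (+ c))) nut)
    where
    neg₁ : ∀ a b → - (a - b) ≡ - a - - b
    neg₁ = solve-∀
    neg₂ : ∀ a b c → - (a + b - c) ≡ - a + - b + c
    neg₂ = solve-∀
    neg₃ : ∀ a b → - (a + b) ≡ - a - b
    neg₃ = solve-∀
    neg₄ : ∀ a b c → - (a - b - c) ≡ - a + b + c
    neg₄ = solve-∀

  v2-conditions : IsNut (B2 m a b c) → v2 c < v2 m → ¬ (suc (v2 a) ≡ v2 c) × ¬ (suc (v2 b) ≡ v2 c)
  v2-conditions nut v2c<v2m =
      (λ 1+v2a≡v2c → alternating-obstructionˣ 0<T 2T∣m (2^v2-residue-of-double 0<a 1+v2a≡v2c) 2T∣c-T nut)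
    , (λ 1+v2b≡v2c → alternating-obstructionʸ 0<T 2T∣m (2^v2-residue-of-double 0<b 1+v2b≡v2c) 2T∣c-T nut)
    where
    0<T : 0 < 2 ^ v2 c
    0<T = ℕP.m^n>0 2 (v2 c)
    2T∣m : + (2 * 2 ^ v2 c) ∣ + m
    2T∣m = 2^k∣n 0<m v2c<v2m
    2T∣c-T : + (2 * 2 ^ v2 c) ∣ + c - + 2 ^ v2 c
    2T∣c-T = 2^v2-residue 0<c

lemma4p4 : (m a b c : ℕ) → .{{_ : NonZero m}} →
    3 ≤ m → 1 ≤ a → a ≤ b → 2 * b < m → 1 ≤ c → 2 * c ≤ m →
    ¬ ( ( Coprime m (gcdℤ (+ a ℤ.- + b) (+ a ℤ.+ + b ℤ.+ + c))
        × Coprime m (gcdℤ (+ a ℤ.- + b) (+ a ℤ.+ + b ℤ.- + c))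
        × Coprime m (gcdℤ (+ a ℤ.+ + b) (+ a ℤ.- + b ℤ.+ + c))
        × Coprime m (gcdℤ (+ a ℤ.+ + b) (+ a ℤ.- + b ℤ.- + c)) )
      × ( v2 c < v2 m → ¬ (suc (v2 a) ≡ v2 c) × ¬ (suc (v2 b) ≡ v2 c) ) ) →
    ¬ IsNut (B2 m a b c)
lemma4p4 m a b c _ 0<a a≤b 2*b<m 0<c 2*c≤m conditions-fail nut = conditions-fail
  ( coprimality-conditions 0<a 2a<m 0<b 2b<m 0<c c<m nut
  , v2-conditions 0<a 2a<m 0<b 2b<m 0<c c<m nut )
  where
  0<b : 0 < b
  0<b = ℕP.≤-trans 0<a a≤b
  2b<m : b ℕ.+ b < m
  2b<m = subst (_< m) (cong (b ℕ.+_) (ℕP.+-identityʳ b)) 2*b<m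
  2a<m : a ℕ.+ a < m
  2a<m = ℕP.≤-<-trans (ℕP.+-mono-≤ a≤b a≤b) 2b<m
  c<m : c < m
  c<m = ℕP.<-≤-trans (ℕP.m<m+n c (ℕP.<-≤-trans 0<c (ℕP.m≤m+n c 0))) 2*c≤m
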